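{- Let $G$ be a graph, let $S\subseteq V(G)$, and let $\tau$ be an MVD-coloring of $G$. Then the restriction of $\tau$ to the induced subgraph $G[S]$ is an MVD-coloring of $G[S]$.
   Context: For a vertex-colored graph $H$ and two nonadjacent vertices $x,y$ of $H$, an $x$-$y$ vertex cut is a set $D\subseteq V(H)\setminus\{x,y\}$ such that $x$ and $y$ lie in different components of $H-D$; it is monochromatic if all its vertices have the same color. A vertex-coloring of $H$ is an MVD-coloring if every pair of nonadjacent vertices of $H$ has a monochromatic vertex cut separating them. -}

module Defs where

open import Level using (Level; _⊔_) renaming (suc to lsuc; zero to lzero)
open import Data.Nat using (ℕ)
open import Data.Fin using (Fin)
open import Data.Fin.Subset using (Subset; _∈_)
open import Data.Product using (Σ; _×_; _,_; proj₁)
open import Relation.Binary.PropositionalEquality using (_≡_)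
open import Relation.Nullary using (¬_)

record Graph (V : Set) : Set₁ where
  field
    Adj      : V → V → Set
    sym      : ∀ {x y} → Adj x y → Adj y x
    irrefl   : ∀ {x} → ¬ Adj x x
open Graph public

Vert[_] : {n : ℕ} → Subset n → Set
Vert[ S ] = Σ (Fin _) (λ v → v ∈ S)

induced : {n : ℕ} → Graph (Fin n) → (S : Subset n) → Graph (Vert[ S ])
induced G S = record
  { Adj    = λ x y → Adj G (proj₁ x) (proj₁ y)
  ; sym    = sym G
  ; irrefl = irrefl G
  }

data WalkAvoiding {V : Set} (H : Graph V) (D : V → Set) : V → V → Set where
  [_]  : ∀ {x} → ¬ D x → WalkAvoiding H D x x
  _∷_  : ∀ {x y z} → ¬ D x → Adj H x y → WalkAvoiding H D y z →
         WalkAvoiding H D x z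
  -- (the endpoint condition for y is carried by the tail)

IsVertexCut : {V : Set} → Graph V → (V → Set) → V → V → Set
IsVertexCut H D x y =
  ¬ D x × ¬ D y × ¬ WalkAvoiding H D x y

Monochromatic : {V C : Set} → (V → C) → (V → Set) → Set
Monochromatic τ D = ∀ u v → D u → D v → τ u ≡ τ v

IsMVD : {V C : Set} → Graph V → (V → C) → Set₁
IsMVD {V} H τ =
  ∀ x y → ¬ x ≡ y → ¬ Adj H x y →
  Σ (V → Set) (λ D → IsVertexCut H D x y × Monochromatic τ D)

module Submission where

open import Defs
open import Data.Nat using (ℕ)
open import Data.Fin using (Fin)
open import Data.Fin.Subset using (Subset; _∈_)
open import Data.Vec.Properties.WithK using ([]=-irrelevant)
open import Data.Product using (_,_; proj₁)
open import Function using (_∘_; id)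
open import Function.Definitions using (Injective)
open import Relation.Binary.PropositionalEquality using (_≡_; refl; cong)

-- Since G[S] is an induced subgraph, proj₁ both preserves and reflects
-- adjacency; a separating cut D of G therefore restricts to the cut D ∩ S of
-- G[S], because any walk in G[S] − (D ∩ S) is a walk in G − D.

module _ {V W : Set} {H : Graph V} {G : Graph W} (f : V → W)
         (f-hom : ∀ {x y} → Adj H x y → Adj G (f x) (f y)) where

  map-WalkAvoiding : ∀ {D : W → Set} {x y} →
    WalkAvoiding H (D ∘ f) x y → WalkAvoiding G D (f x) (f y)
  map-WalkAvoiding [ x∉D ]        = [ x∉D ]
  map-WalkAvoiding (_∷_ x∉D xy w) = _∷_ x∉D (f-hom xy) (map-WalkAvoiding w)

  IsVertexCut-preimage : ∀ {D : W → Set} {x y} →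
    IsVertexCut G D (f x) (f y) → IsVertexCut H (D ∘ f) x y
  IsVertexCut-preimage (x∉D , y∉D , no-walk) =
    x∉D , y∉D , no-walk ∘ map-WalkAvoiding

Monochromatic-preimage : ∀ {U V C : Set} (f : U → V) {τ : V → C} {D : V → Set} →
  Monochromatic τ D → Monochromatic (τ ∘ f) (D ∘ f)
Monochromatic-preimage f mono u v = mono (f u) (f v)

IsMVD-preimage : ∀ {V W C : Set} {H : Graph V} {G : Graph W} {τ : W → C}
  (f : V → W) → Injective _≡_ _≡_ f →
  (∀ {x y} → Adj H x y → Adj G (f x) (f y)) →
  (∀ {x y} → Adj G (f x) (f y) → Adj H x y) →
  IsMVD G τ → IsMVD H (τ ∘ f)
IsMVD-preimage f f-inj f-hom f-reflects mvd x y x≢y x≁y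
  with mvd (f x) (f y) (x≢y ∘ f-inj) (x≁y ∘ f-reflects)
... | D , cut , mono =
  D ∘ f , IsVertexCut-preimage f f-hom cut , Monochromatic-preimage f mono

proj₁-injective : ∀ {n} {S : Subset n} → Injective _≡_ _≡_ (proj₁ {B = _∈ S})
proj₁-injective {x = v , p} {y = .v , q} refl = cong (v ,_) ([]=-irrelevant p q)

lemma2p1 : {n : ℕ} {C : Set} (G : Graph (Fin n)) (S : Subset n) (τ : Fin n → C) →
    IsMVD G τ → IsMVD (induced G S) (τ ∘ proj₁)
lemma2p1 G S τ = IsMVD-preimage proj₁ proj₁-injective id id
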